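{- Let $K$ be a Henselian valued field whose residue field has characteristic different from $2$, with value group $\Gamma$, and let $\Delta\subseteq\Gamma$ be convex with $0\in\Delta$. Let $x\in K$ with $v(x)=0$. Then $x$ is a square in $K$ if and only if $x(1+\mathcal{M}_\Delta)$ is a square in $H_\Delta=K/(1+\mathcal{M}_\Delta)$, i.e. there is $Y\in H_\Delta$ with $Y\cdot Y=x(1+\mathcal{M}_\Delta)$.
   Context: "Convex" means: $h\in\Delta$ and $g\le h$ imply $g\in\Delta$. $\mathcal{M}_\Delta=\{x\in K: v(x)>\gamma\text{ for all }\gamma\in\Delta\}$. $H_\Delta$ is the set of orbits $y(1+\mathcal{M}_\Delta)$, $y\in K$, with multiplication $y(1+\mathcal{M}_\Delta)\cdot z(1+\mathcal{M}_\Delta)=yz(1+\mathcal{M}_\Delta)$. -}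

module Defs where

open import Level using (Level; _⊔_; suc; zero)
open import Data.Product using (Σ; ∃; _×_; _,_)
open import Data.Sum using (_⊎_)
open import Data.Nat as ℕ using (ℕ)
open import Data.List using (List; []; _∷_)
open import Data.List.Relation.Unary.All using (All)
open import Relation.Nullary using (¬_)
open import Relation.Binary.PropositionalEquality using (_≡_)
open import Algebra.Bundles using (CommutativeRing)
open import Algebra.Structures using (IsAbelianGroup)
open import Relation.Binary.Structures using (IsTotalOrder)
open import Function.Bundles using (_⇔_)

record IsField {c ℓ} (R : CommutativeRing c ℓ) : Set (c ⊔ ℓ) where
  open CommutativeRing R
  field
    1≉0   : ¬ (1# ≈ 0#)
    inverse : ∀ x → ¬ (x ≈ 0#) → Σ Carrier (λ y → x * y ≈ 1#)

record OrderedAbelianGroup : Set₁ where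
  infixl 6 _+_
  infix 4 _≤_
  field
    Carrier : Set
    _+_     : Carrier → Carrier → Carrier
    0g      : Carrier
    -_      : Carrier → Carrier
    _≤_     : Carrier → Carrier → Set
    isAbelianGroup : IsAbelianGroup _≡_ _+_ 0g -_
    isTotalOrder   : IsTotalOrder _≡_ _≤_
    +-mono         : ∀ {a b} c → a ≤ b → a + c ≤ b + c

  _<_ : Carrier → Carrier → Set
  a < b = a ≤ b × ¬ (a ≡ b)

module _ (Γ : OrderedAbelianGroup) where
  open OrderedAbelianGroup Γ

  data Γ∞ : Set where
    fin : Carrier → Γ∞
    ∞   : Γ∞

  infix 4 _≤∞_
  data _≤∞_ : Γ∞ → Γ∞ → Set where
    fin≤fin : ∀ {a b} → a ≤ b → fin a ≤∞ fin b
    _≤∞∞    : ∀ x → x ≤∞ ∞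

  infix 4 _<∞_
  _<∞_ : Γ∞ → Γ∞ → Set
  x <∞ y = x ≤∞ y × ¬ (x ≡ y)

  infixl 6 _+∞_
  _+∞_ : Γ∞ → Γ∞ → Γ∞
  fin a +∞ fin b = fin (a + b)
  fin a +∞ ∞     = ∞
  ∞     +∞ _     = ∞

record ValuedField c ℓ : Set (suc (c ⊔ ℓ)) where
  field
    ring     : CommutativeRing c ℓ
    isField  : IsField ring
    Γ        : OrderedAbelianGroup
  open CommutativeRing ring
  open OrderedAbelianGroup Γ using () renaming (Carrier to ΓC)
  field
    v        : Carrier → Γ∞ Γ
    v-cong   : ∀ {x y} → x ≈ y → v x ≡ v y
    v-∞      : ∀ x → (v x ≡ ∞) ⇔ (x ≈ 0#)
    v-*      : ∀ x y → v (x * y) ≡ _+∞_ Γ (v x) (v y)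
    v-+      : ∀ x y → _≤∞_ Γ (v x) (v (x + y)) ⊎ _≤∞_ Γ (v y) (v (x + y))
    v-onto   : ∀ (γ : ΓC) → Σ Carrier (λ x → v x ≡ fin γ)

  InO : Carrier → Set
  InO x = _≤∞_ Γ (fin (OrderedAbelianGroup.0g Γ)) (v x)

  In𝔪 : Carrier → Set
  In𝔪 x = _<∞_ Γ (fin (OrderedAbelianGroup.0g Γ)) (v x)

  -- polynomials as coefficient lists, constant coefficient first
  natMul : ℕ → Carrier → Carrier
  natMul ℕ.zero    a = 0#
  natMul (ℕ.suc n) a = a + natMul n a

  eval : List Carrier → Carrier → Carrier
  eval []       x = 0#
  eval (a ∷ as) x = a + x * eval as x

  derivAux : ℕ → List Carrier → List Carrier
  derivAux n []       = []
  derivAux n (a ∷ as) = natMul n a ∷ derivAux (ℕ.suc n) as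

  deriv : List Carrier → List Carrier
  deriv []       = []
  deriv (_ ∷ as) = derivAux 1 as

  -- Henselian: Hensel's lemma for simple roots modulo 𝔪
  IsHenselian : Set (c ⊔ ℓ)
  IsHenselian = ∀ (f : List Carrier) → All InO f →
    ∀ a → InO a → In𝔪 (eval f a) → ¬ In𝔪 (eval (deriv f) a) →
    Σ Carrier (λ b → InO b × eval f b ≈ 0# × In𝔪 (b - a))

  ResidueCharNot2 : Set
  ResidueCharNot2 = ¬ In𝔪 (1# + 1#)

  module _ (Δ : ΓC → Set) where
    open OrderedAbelianGroup Γ using () renaming (_≤_ to _≤Γ_; 0g to 0Γ)

    Convex : Set
    Convex = ∀ {g h} → Δ h → g ≤Γ h → Δ g

    M : Carrier → Set
    M x = ∀ γ → Δ γ → _<∞_ Γ (fin γ) (v x)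

    Orbit : Carrier → Carrier → Set (c ⊔ ℓ)
    Orbit y z = Σ Carrier (λ m → M m × z ≈ y * (1# + m))

    -- equality of orbits (as subsets of K), i.e. equality in H_Δ
    _≐_ : Carrier → Carrier → Set (c ⊔ ℓ)
    y ≐ z = ∀ w → Orbit y w ⇔ Orbit z w

    -- x(1 + 𝓜_Δ) is a square in H_Δ: some Y = y(1 + 𝓜_Δ) has
    -- Y · Y = (y·y)(1 + 𝓜_Δ) equal to x(1 + 𝓜_Δ)
    IsSquareInH : Carrier → Set (c ⊔ ℓ)
    IsSquareInH x = Σ Carrier (λ y → (y * y) ≐ x)

  IsSquare : Carrier → Set (c ⊔ ℓ)
  IsSquare x = Σ Carrier (λ y → y * y ≈ x)

-- If x(1 + 𝓜_Δ) = y²(1 + 𝓜_Δ), then x = y²(1 + m) with m ∈ 𝓜_Δ. As 0 ∈ Δ, m lies in the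
-- maximal ideal, so 1 is a root of X² − (1 + m) modulo 𝔪, and a simple one since 2 ∉ 𝔪.
-- Hensel's lemma lifts it to a square root of 1 + m, whence x is a square. The converse
-- is immediate.
module Submission where

open import Defs
open import Data.Product using (_,_; proj₁)
open import Data.Sum using (inj₁; inj₂)
open import Data.Empty using (⊥-elim)
open import Data.List using (List; []; _∷_)
open import Data.List.Relation.Unary.All using (_∷_; [])
open import Function.Base using (_∘_)
open import Function.Bundles using (_⇔_; mk⇔; Equivalence)
open import Relation.Nullary using (¬_)
open import Relation.Binary.PropositionalEquality as ≡ using (_≡_)
open import Relation.Binary.Structures using (IsTotalOrder)
open import Algebra.Bundles using (AbelianGroup; CommutativeRing)

module OrderedAbelianGroupProperties (Γ : OrderedAbelianGroup) where
  open OrderedAbelianGroup Γ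
  open IsTotalOrder isTotalOrder using (total; antisym) renaming (trans to ≤-trans)

  abelianGroup : AbelianGroup _ _
  abelianGroup = record
    { _≈_ = _≡_ ; _∙_ = _+_ ; ε = 0g ; _⁻¹ = -_ ; isAbelianGroup = isAbelianGroup }

  open AbelianGroup abelianGroup using (identityˡ)
  open import Algebra.Properties.AbelianGroup abelianGroup using (identityʳ-unique)

  x+x≡0⇒x≡0 : ∀ {x} → x + x ≡ 0g → x ≡ 0g
  x+x≡0⇒x≡0 {x} x+x≡0 with total 0g x
  ... | inj₁ 0≤x = antisym (≡.subst₂ _≤_ (identityˡ x) x+x≡0 (+-mono x 0≤x)) 0≤x
  ... | inj₂ x≤0 = antisym x≤0 (≡.subst₂ _≤_ x+x≡0 (identityˡ x) (+-mono x x≤0))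

  fin-injective : ∀ {x y} → fin {Γ = Γ} x ≡ fin y → x ≡ y
  fin-injective ≡.refl = ≡.refl

  ≤∞-trans : ∀ {x y z} → _≤∞_ Γ x y → _≤∞_ Γ y z → _≤∞_ Γ x z
  ≤∞-trans (fin≤fin x≤y) (fin≤fin y≤z) = fin≤fin (≤-trans x≤y y≤z)
  ≤∞-trans {x} _         (_ ≤∞∞)       = x ≤∞∞

  +∞-identityˡ : ∀ x → _+∞_ Γ (fin 0g) x ≡ x
  +∞-identityˡ (fin x) = ≡.cong fin (identityˡ x)
  +∞-identityˡ ∞       = ≡.refl

  x+∞x≡x⇒x≡0 : ∀ {x} → ¬ (x ≡ ∞) → _+∞_ Γ x x ≡ x → x ≡ fin 0g
  x+∞x≡x⇒x≡0 {fin x} _   x+x≡x = ≡.cong fin (identityʳ-unique x x (fin-injective x+x≡x))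
  x+∞x≡x⇒x≡0 {∞}     x≢∞ _     = ⊥-elim (x≢∞ ≡.refl)

  x+∞x≡0⇒x≡0 : ∀ {x} → _+∞_ Γ x x ≡ fin 0g → x ≡ fin 0g
  x+∞x≡0⇒x≡0 {fin x} x+x≡0 = ≡.cong fin (x+x≡0⇒x≡0 (fin-injective x+x≡0))
  x+∞x≡0⇒x≡0 {∞}     ()

module ValuedFieldProperties {c ℓ} (K : ValuedField c ℓ) where
  open ValuedField K
  open CommutativeRing ring hiding (ring)
  open IsField isField using (1≉0)
  open OrderedAbelianGroup Γ using () renaming (Carrier to ΓC; 0g to 0Γ)
  open OrderedAbelianGroupProperties Γ
  open import Algebra.Properties.Ring (CommutativeRing.ring ring) using (-1*x≈-x)
  open import Algebra.Properties.Group +-group using (⁻¹-involutive; x∙y⁻¹≈ε⇒x≈y)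
  open import Algebra.Properties.AbelianGroup +-abelianGroup using (⁻¹-anti-homo‿-; xyx⁻¹≈y)
  open import Algebra.Properties.CommutativeSemigroup *-commutativeSemigroup using (interchange)

  v-0 : v 0# ≡ ∞
  v-0 = Equivalence.from (v-∞ 0#) refl

  v-1 : v 1# ≡ fin 0Γ
  v-1 = x+∞x≡x⇒x≡0 (1≉0 ∘ Equivalence.to (v-∞ 1#))
                   (≡.trans (≡.sym (v-* 1# 1#)) (v-cong (*-identityʳ 1#)))

  v-neg : ∀ x → v (- x) ≡ v x
  v-neg x = begin
    v (- x)                  ≡⟨ v-cong (sym (-1*x≈-x x)) ⟩
    v (- 1# * x)             ≡⟨ v-* (- 1#) x ⟩
    _+∞_ Γ (v (- 1#)) (v x)  ≡⟨ ≡.cong (λ t → _+∞_ Γ t (v x)) v-[-1] ⟩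
    _+∞_ Γ (fin 0Γ) (v x)    ≡⟨ +∞-identityˡ (v x) ⟩
    v x                      ∎
    where
    open ≡.≡-Reasoning

    -1*-1≈1 : - 1# * - 1# ≈ 1#
    -1*-1≈1 = trans (-1*x≈-x (- 1#)) (⁻¹-involutive 1#)

    v-[-1] : v (- 1#) ≡ fin 0Γ
    v-[-1] = x+∞x≡0⇒x≡0 (≡.trans (≡.sym (v-* (- 1#) (- 1#))) (≡.trans (v-cong -1*-1≈1) v-1))

  In𝔪-resp-≈ : ∀ {x y} → x ≈ y → In𝔪 x → In𝔪 y
  In𝔪-resp-≈ x≈y = ≡.subst (_<∞_ Γ (fin 0Γ)) (v-cong x≈y)

  InO-0 : InO 0#
  InO-0 = ≡.subst (_≤∞_ Γ (fin 0Γ)) (≡.sym v-0) (fin 0Γ ≤∞∞)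

  InO-1 : InO 1#
  InO-1 = ≡.subst (_≤∞_ Γ (fin 0Γ)) (≡.sym v-1) (fin≤fin ≤-refl)
    where open IsTotalOrder (OrderedAbelianGroup.isTotalOrder Γ) using () renaming (refl to ≤-refl)

  InO-neg : ∀ {x} → InO x → InO (- x)
  InO-neg {x} = ≡.subst (_≤∞_ Γ (fin 0Γ)) (≡.sym (v-neg x))

  In𝔪-neg : ∀ {x} → In𝔪 x → In𝔪 (- x)
  In𝔪-neg {x} = ≡.subst (_<∞_ Γ (fin 0Γ)) (≡.sym (v-neg x))

  InO-+ : ∀ {x y} → InO x → InO y → InO (x + y)
  InO-+ {x} {y} x∈O y∈O with v-+ x y
  ... | inj₁ vx≤ = ≤∞-trans x∈O vx≤
  ... | inj₂ vy≤ = ≤∞-trans y∈O vy≤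

  In𝔪⇒InO : ∀ {x} → In𝔪 x → InO x
  In𝔪⇒InO = proj₁

  X²-_ : Carrier → List Carrier
  X²- a = - a ∷ 0# ∷ 1# ∷ []

  eval-X²- : ∀ a b → eval (X²- a) b ≈ b * b - a
  eval-X²- a b = begin
    - a + b * (0# + b * (1# + b * 0#)) ≈⟨ +-congˡ (*-congˡ (+-identityˡ _)) ⟩
    - a + b * (b * (1# + b * 0#))      ≈⟨ +-congˡ (*-congˡ (*-congˡ (+-congˡ (zeroʳ b)))) ⟩
    - a + b * (b * (1# + 0#))          ≈⟨ +-congˡ (*-congˡ (*-congˡ (+-identityʳ 1#))) ⟩
    - a + b * (b * 1#)                 ≈⟨ +-congˡ (*-congˡ (*-identityʳ b)) ⟩
    - a + b * b                        ≈⟨ +-comm (- a) (b * b) ⟩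
    b * b - a                          ∎
    where open import Relation.Binary.Reasoning.Setoid setoid

  eval-deriv-X²- : ∀ a b → eval (deriv (X²- a)) b ≈ b + b
  eval-deriv-X²- a b = begin
    (0# + 0#) + b * ((1# + (1# + 0#)) + b * 0#) ≈⟨ +-congʳ (+-identityʳ 0#) ⟩
    0# + b * ((1# + (1# + 0#)) + b * 0#)        ≈⟨ +-identityˡ _ ⟩
    b * ((1# + (1# + 0#)) + b * 0#)             ≈⟨ *-congˡ (+-congˡ (zeroʳ b)) ⟩
    b * ((1# + (1# + 0#)) + 0#)                 ≈⟨ *-congˡ (+-identityʳ _) ⟩
    b * (1# + (1# + 0#))                        ≈⟨ *-congˡ (+-congˡ (+-identityʳ 1#)) ⟩
    b * (1# + 1#)                               ≈⟨ distribˡ b 1# 1# ⟩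
    b * 1# + b * 1#                             ≈⟨ +-cong (*-identityʳ b) (*-identityʳ b) ⟩
    b + b                                       ∎
    where open import Relation.Binary.Reasoning.Setoid setoid

  IsSquare-resp-≈ : ∀ {a b} → a ≈ b → IsSquare a → IsSquare b
  IsSquare-resp-≈ a≈b (y , y²≈a) = y , trans y²≈a a≈b

  IsSquare-* : ∀ {a b} → IsSquare a → IsSquare b → IsSquare (a * b)
  IsSquare-* (y , y²≈a) (z , z²≈b) = y * z , trans (interchange y z y z) (*-cong y²≈a z²≈b)

  hensel-sqrt : IsHenselian → ∀ {a c} → InO a → InO c →
                In𝔪 (a - c * c) → ¬ In𝔪 (c + c) → IsSquare a
  hensel-sqrt hensel {a} {c} a∈O c∈O a-c²∈𝔪 2c∉𝔪
    with hensel (X²- a) (InO-neg a∈O ∷ InO-0 ∷ InO-1 ∷ []) c c∈O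
                (In𝔪-resp-≈ (trans (⁻¹-anti-homo‿- a (c * c)) (sym (eval-X²- a c))) (In𝔪-neg a-c²∈𝔪))
                (2c∉𝔪 ∘ In𝔪-resp-≈ (eval-deriv-X²- a c))
  ... | b , _ , f[b]≈0 , _ = b , x∙y⁻¹≈ε⇒x≈y (b * b) a (trans (sym (eval-X²- a b)) f[b]≈0)

  1+𝔪-isSquare : IsHenselian → ResidueCharNot2 → ∀ {m} → In𝔪 m → IsSquare (1# + m)
  1+𝔪-isSquare hensel char≠2 {m} m∈𝔪 =
    hensel-sqrt hensel (InO-+ InO-1 (In𝔪⇒InO m∈𝔪)) InO-1
                (In𝔪-resp-≈ (sym 1+m-1*1≈m) m∈𝔪) char≠2
    where
    1+m-1*1≈m : 1# + m - 1# * 1# ≈ m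
    1+m-1*1≈m = trans (+-congˡ (-‿cong (*-identityʳ 1#))) (xyx⁻¹≈y 1# m)

  module _ (Δ : ΓC → Set) where

    M-0 : M Δ 0#
    M-0 γ _ = ≡.subst (_<∞_ Γ (fin γ)) (≡.sym v-0) (fin γ ≤∞∞ , λ ())

    Orbit-refl : ∀ y → Orbit Δ y y
    Orbit-refl y = 0# , M-0 , sym (trans (*-congˡ (+-identityʳ 1#)) (*-identityʳ y))

    ≈⇒≐ : ∀ {y z} → y ≈ z → _≐_ Δ y z
    ≈⇒≐ y≈z w = mk⇔ (λ (m , m∈M , w≈y[1+m]) → m , m∈M , trans w≈y[1+m] (*-congʳ y≈z))
                    (λ (m , m∈M , w≈z[1+m]) → m , m∈M , trans w≈z[1+m] (*-congʳ (sym y≈z)))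

    ≐⇒Orbit : ∀ {y z} → _≐_ Δ y z → Orbit Δ y z
    ≐⇒Orbit {z = z} y≐z = Equivalence.from (y≐z z) (Orbit-refl z)

mainTheorem7 : ∀ {c ℓ} (K : ValuedField c ℓ) →
    ValuedField.IsHenselian K → ValuedField.ResidueCharNot2 K →
    (Δ : OrderedAbelianGroup.Carrier (ValuedField.Γ K) → Set) →
    ValuedField.Convex K Δ → Δ (OrderedAbelianGroup.0g (ValuedField.Γ K)) →
    (x : CommutativeRing.Carrier (ValuedField.ring K)) →
    ValuedField.v K x ≡ fin (OrderedAbelianGroup.0g (ValuedField.Γ K)) →
    ValuedField.IsSquare K x ⇔ ValuedField.IsSquareInH K Δ x
mainTheorem7 K hensel char≠2 Δ _ 0∈Δ x _ = mk⇔ square⇒squareInH squareInH⇒square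
  where
  open ValuedField K
  open CommutativeRing ring using (refl; sym)
  open ValuedFieldProperties K

  square⇒squareInH : IsSquare x → IsSquareInH Δ x
  square⇒squareInH (y , y²≈x) = y , ≈⇒≐ Δ y²≈x

  squareInH⇒square : IsSquareInH Δ x → IsSquare x
  squareInH⇒square (y , y²≐x) with ≐⇒Orbit Δ y²≐x
  ... | m , m∈M , x≈y²[1+m] =
    IsSquare-resp-≈ (sym x≈y²[1+m])
      (IsSquare-* (y , refl) (1+𝔪-isSquare hensel char≠2 (m∈M _ 0∈Δ)))
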